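{- Let $w\in\mathfrak{S}_n$ be right-almost-reducible at $i$ and left-almost-reducible at $j$. Then $i\ne j$ and $s_is_j=s_js_i$.
   Context: $\mathfrak{S}_n$ is the Coxeter group with simple generators $S=\{s_1,\dots,s_{n-1}\}$, $s_i=(i\ i+1)$, length $\ell$. $\supp(x)$ is the set of simple generators in any reduced word of $x$; $D_L(x)=\{s\in S:\ell(sx)<\ell(x)\}$, $D_R(x)=\{s\in S:\ell(xs)<\ell(x)\}$. For $J\subseteq S$, $W_J=\langle J\rangle$ and each $x$ factors uniquely as $x=x^Jx_J$, $x_J\in W_J$, $x^J$ the minimal-length element of $xW_J$. $w=w^Jw_J$ is a Billey–Postnikov decomposition if $\supp(w^J)\cap J\subseteq D_L(w_J)$. $w$ is Bruhat irreducible if $\supp(w)=S$ and there is no factorization $w=w'w''$ with $w',w''\neq e$ and $\supp(w')\cap\supp(w'')=\emptyset$. A Bruhat irreducible $w$ is almost reducible at $(J,i)$ if $w=w^Jw_J$ is a BP decomposition with $\supp(w^J)\cap J=\{s_i\}$ and $s_i\notin D_L(w)\cup D_R(w)$. It is right-almost-reducible at $i$ if almost reducible at $(\{s_i,\dots,s_{n-1}\},i)$, and left-almost-reducible at $j$ if almost reducible at $(\{s_1,\dots,s_j\},j)$. -}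

module Defs where

open import Data.Nat using (ℕ; suc; _≤_; _<_)
open import Data.Fin using (Fin; inject₁) renaming (suc to fsuc; _≤_ to _≤ᶠ_)
open import Data.Fin.Permutation using (Permutation′; _⟨$⟩ʳ_; _∘ₚ_; transpose; id)
open import Data.List using (List; []; _∷_; length)
open import Data.List.Membership.Propositional using (_∈_)
open import Data.List.Relation.Unary.All using (All)
open import Data.Product using (Σ; ∃; _×_; _,_)
open import Relation.Binary.PropositionalEquality using (_≡_)
open import Relation.Nullary using (¬_)
open import Data.Empty using (⊥)

-- The symmetric group 𝔖ₙ with n = suc m, as permutations of Fin n.
-- Simple generators s₁,…,s_{n-1} are indexed by  i : Fin m  (0-based:
-- the index i stands for the paper's s_{i+1}) and  s i  swaps the
-- points inject₁ i and suc i.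

𝔖 : ℕ → Set
𝔖 m = Permutation′ (suc m)

-- Group product: (x · y) k = x (y k)   (y ∘ₚ x means "first y, then x").
infixl 7 _·_
_·_ : ∀ {m} → 𝔖 m → 𝔖 m → 𝔖 m
x · y = y ∘ₚ x

e : ∀ {m} → 𝔖 m
e = id

infix 4 _≈_
_≈_ : ∀ {m} → 𝔖 m → 𝔖 m → Set
x ≈ y = ∀ k → x ⟨$⟩ʳ k ≡ y ⟨$⟩ʳ k

s : ∀ {m} → Fin m → 𝔖 m
s i = transpose (inject₁ i) (fsuc i)

Word : ℕ → Set
Word m = List (Fin m)

⟦_⟧ : ∀ {m} → Word m → 𝔖 m
⟦ [] ⟧    = e
⟦ i ∷ w ⟧ = s i · ⟦ w ⟧

Reduced : ∀ {m} → 𝔖 m → Word m → Set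
Reduced x w = (⟦ w ⟧ ≈ x) × (∀ v → ⟦ v ⟧ ≈ x → length w ≤ length v)

HasLength : ∀ {m} → 𝔖 m → ℕ → Set
HasLength x k = Σ (Word _) λ w → Reduced x w × length w ≡ k

ShorterThan : ∀ {m} → 𝔖 m → 𝔖 m → Set
ShorterThan x y = ∃ λ k → ∃ λ l → HasLength x k × HasLength y l × k < l

NotLongerThan : ∀ {m} → 𝔖 m → 𝔖 m → Set
NotLongerThan x y = ∃ λ k → ∃ λ l → HasLength x k × HasLength y l × k ≤ l

-- Support: s_i ∈ supp(x) iff s_i occurs in a reduced word of x
-- (all reduced words of x have the same support).
InSupp : ∀ {m} → Fin m → 𝔖 m → Set
InSupp i x = Σ (Word _) λ w → Reduced x w × i ∈ w

InDL : ∀ {m} → Fin m → 𝔖 m → Set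
InDL i x = ShorterThan (s i · x) x

InDR : ∀ {m} → Fin m → 𝔖 m → Set
InDR i x = ShorterThan (x · s i) x

Subset : ℕ → Set₁
Subset m = Fin m → Set

InParabolic : ∀ {m} → Subset m → 𝔖 m → Set
InParabolic J x = Σ (Word _) λ w → All J w × ⟦ w ⟧ ≈ x

InCoset : ∀ {m} → Subset m → 𝔖 m → 𝔖 m → Set
InCoset J x u = ∃ λ v → InParabolic J v × u ≈ x · v

IsMinCosetRep : ∀ {m} → Subset m → 𝔖 m → 𝔖 m → Set
IsMinCosetRep J x u = InCoset J x u × (∀ u′ → InCoset J x u′ → NotLongerThan u u′)

IsParabolicFactorisation : ∀ {m} → Subset m → 𝔖 m → 𝔖 m → 𝔖 m → Set
IsParabolicFactorisation J x u v =
  (x ≈ u · v) × InParabolic J v × IsMinCosetRep J x u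

BruhatIrreducible : ∀ {m} → 𝔖 m → Set
BruhatIrreducible {m} w =
  (∀ (k : Fin m) → InSupp k w) ×
  ¬ (∃ λ w′ → ∃ λ w″ → (w ≈ w′ · w″) × ¬ (w′ ≈ e) × ¬ (w″ ≈ e) ×
       (∀ k → InSupp k w′ → InSupp k w″ → ⊥))

AlmostReducible : ∀ {m} → 𝔖 m → Subset m → Fin m → Set
AlmostReducible w J i =
  BruhatIrreducible w ×
  ∃ λ u → ∃ λ v → IsParabolicFactorisation J w u v ×
    (∀ k → InSupp k u → J k → InDL k v) ×
    (∀ k → InSupp k u → J k → k ≡ i) × InSupp i u × J i ×
    ¬ InDL i w × ¬ InDR i w

RightAlmostReducible : ∀ {m} → 𝔖 m → Fin m → Set
RightAlmostReducible w i = AlmostReducible w (λ k → i ≤ᶠ k) i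

LeftAlmostReducible : ∀ {m} → 𝔖 m → Fin m → Set
LeftAlmostReducible w j = AlmostReducible w (λ k → k ≤ᶠ j) j

-- Points are 0, …, m and s k swaps k and k + 1.  Coxeter length equals the number of
-- inversions, so descents and minimality in a coset become order conditions on points, and
-- k ∈ supp x forces x to send some point ≤ k above k.  Write w = u v with u = w^J.  If w is
-- right-almost-reducible at i, the letters of a reduced word of u are ≤ i and include i, and
-- u i < u (i + 1); this forces u⁻¹ (i + 1) < i, and since v fixes the points below i and
-- s i ∉ D_L(w), both w⁻¹ i and w⁻¹ (i + 1) lie below i.  Symmetrically, left-almost-reducibility at j puts
-- w⁻¹ j and w⁻¹ (j + 1) at or above j + 2.  Hence {i , i + 1} and {j , j + 1} are disjoint:
-- s i and s j move disjoint sets of points, so they commute.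

module Submission where

open import Defs
open import Data.Fin using (Fin)
open import Relation.Binary.PropositionalEquality using (_≢_)
open import Data.Product using (_×_)

open import Data.Empty using (⊥; ⊥-elim)
open import Data.Fin using (toℕ; inject₁) renaming (suc to fsuc; zero to fzero)
open import Data.Fin.Induction using (<-weakInduction)
open import Data.Fin.Permutation using (_⟨$⟩ʳ_; _⟨$⟩ˡ_; inverseˡ; inverseʳ; flip)
open import Data.Fin.Properties using (toℕ-injective; toℕ-inject₁; _≟_; <-cmp; any?; punchInᵢ≢i)
open import Data.List using ([]; _∷_; length; _++_)
open import Data.List.Membership.Propositional using (_∈_)
open import Data.List.Membership.DecPropositional using (_∈?_)
open import Data.List.Relation.Unary.All using (lookup) renaming ([] to []ᵃ; _∷_ to _∷ᵃ_)
open import Data.List.Relation.Unary.All.Properties using (++⁺)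
open import Data.List.Relation.Unary.Any using (here; there)
open import Data.Nat using (ℕ; zero; suc; _+_; _*_; _≤_; _<_; z≤n; s≤s)
open import Data.Nat.Properties
  using (+-0-commutativeMonoid; ≤-refl; ≤-reflexive; ≤-trans; ≤-antisym; ≤-total; ≤-pred; <-trans; <-irrefl;
         <⇒≤; <⇒≢; <⇒≱; ≮⇒≥; ≰⇒>; ≤∧≢⇒<; ≤-<-trans; <-≤-trans; n<1+n; n≤1+n; m≤n⇒m≤1+n; m<n⇒m<1+n; m≤n+m;
         1+n≰n; 1+n≢0; suc-injective; +-identityʳ; +-comm; +-mono-≤; +-monoʳ-≤; +-cancelʳ-≤; +-cancelˡ-≡;
         +-cancelʳ-≡; *-identityˡ; *-comm; _<?_; _≤?_)
  renaming (_≟_ to _≟ℕ_; <-cmp to <-cmpℕ)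
open import Data.Nat.Tactic.RingSolver using (solve-∀)
open import Data.Product using (Σ; ∃; _,_; proj₁; proj₂)
open import Data.Sum using (_⊎_; inj₁; inj₂; swap)
open import Data.Vec.Functional using (removeAt; updateAt)
open import Data.Vec.Functional.Properties using (updateAt-updates; updateAt-minimal)
open import Function using (_∘_)
open import Relation.Binary.Definitions using (tri<; tri≈; tri>)
open import Relation.Binary.PropositionalEquality
  using (_≡_; refl; sym; trans; cong; cong₂; subst; subst₂; module ≡-Reasoning)
open import Relation.Nullary using (¬_; yes; no; contradiction)
open import Relation.Nullary.Decidable using (dec-true; dec-false; _×-dec_)
open import Algebra.Properties.CommutativeMonoid.Sum +-0-commutativeMonoid
  using (sum; sum-cong-≗; sum-permute; sum-remove; ∑-comm; sum-replicate-zero)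

-- Permutations

≈-sym : ∀ {m} {x y : 𝔖 m} → x ≈ y → y ≈ x
≈-sym x≈y z = sym (x≈y z)

lo hi : ∀ {m} → Fin m → Fin (suc m)
lo = inject₁
hi = fsuc

≡lo : ∀ {m} {k : Fin m} {z} → toℕ z ≡ toℕ k → z ≡ lo k
≡lo {k = k} z≡k = toℕ-injective (trans z≡k (sym (toℕ-inject₁ k)))

≡hi : ∀ {m} {k : Fin m} {z} → toℕ z ≡ suc (toℕ k) → z ≡ hi k
≡hi = toℕ-injective

lo≢hi : ∀ {m} (k : Fin m) → lo k ≢ hi k
lo≢hi k lo≡hi = <-irrefl (trans (sym (toℕ-inject₁ k)) (cong toℕ lo≡hi)) (n<1+n (toℕ k))

⟨$⟩ʳ-injective : ∀ {m} (x : 𝔖 m) {a b} → x ⟨$⟩ʳ a ≡ x ⟨$⟩ʳ b → a ≡ b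
⟨$⟩ʳ-injective x eq = trans (sym (inverseˡ x)) (trans (cong (x ⟨$⟩ˡ_) eq) (inverseˡ x))

⟨$⟩ˡ-injective : ∀ {m} (x : 𝔖 m) {a b} → x ⟨$⟩ˡ a ≡ x ⟨$⟩ˡ b → a ≡ b
⟨$⟩ˡ-injective x eq = trans (sym (inverseʳ x)) (trans (cong (x ⟨$⟩ʳ_) eq) (inverseʳ x))

⟨$⟩ˡ-lo≢hi : ∀ {m} (x : 𝔖 m) k → x ⟨$⟩ˡ lo k ≢ x ⟨$⟩ˡ hi k
⟨$⟩ˡ-lo≢hi x k = lo≢hi k ∘ ⟨$⟩ˡ-injective x

fixed⇒inverse-fixed : ∀ {m} (x : 𝔖 m) {z} → x ⟨$⟩ʳ z ≡ z → x ⟨$⟩ˡ z ≡ z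
fixed⇒inverse-fixed x xz≡z = trans (cong (x ⟨$⟩ˡ_) (sym xz≡z)) (inverseˡ x)

⟨$⟩ˡ-· : ∀ {m} {w u v : 𝔖 m} → w ≈ u · v → ∀ y → w ⟨$⟩ˡ y ≡ v ⟨$⟩ˡ (u ⟨$⟩ˡ y)
⟨$⟩ˡ-· {w = w} {u} {v} w≈uv y = trans (cong (w ⟨$⟩ˡ_) (sym w-at)) (inverseˡ w)
  where
  w-at : w ⟨$⟩ʳ (v ⟨$⟩ˡ (u ⟨$⟩ˡ y)) ≡ y
  w-at = trans (w≈uv _) (trans (cong (u ⟨$⟩ʳ_) (inverseʳ v)) (inverseʳ u))

fixing-above⇒preserves-below : ∀ {m} (x : 𝔖 m) c → (∀ z → c ≤ toℕ z → x ⟨$⟩ʳ z ≡ z) →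
  ∀ z → toℕ z < c → toℕ (x ⟨$⟩ʳ z) < c
fixing-above⇒preserves-below x c fixes z z<c with c ≤? toℕ (x ⟨$⟩ʳ z)
... | no c≰xz = ≰⇒> c≰xz
... | yes c≤xz = contradiction c≤xz (<⇒≱ (subst (λ t → toℕ t < c) (sym xz≡z) z<c))
  where
  xz≡z : x ⟨$⟩ʳ z ≡ z
  xz≡z = ⟨$⟩ʳ-injective x (fixes _ c≤xz)

fixed-by-other⇒image-fixed : ∀ {m} (x y : 𝔖 m) → (∀ z → x ⟨$⟩ʳ z ≡ z ⊎ y ⟨$⟩ʳ z ≡ z) →
  ∀ {z} → y ⟨$⟩ʳ z ≡ z → y ⟨$⟩ʳ (x ⟨$⟩ʳ z) ≡ x ⟨$⟩ʳ z
fixed-by-other⇒image-fixed x y one-fixes {z} yz≡z with one-fixes (x ⟨$⟩ʳ z)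
... | inj₂ y-fixes-xz = y-fixes-xz
... | inj₁ x-fixes-xz = trans (cong (y ⟨$⟩ʳ_) xz≡z) (trans yz≡z (sym xz≡z))
  where
  xz≡z : x ⟨$⟩ʳ z ≡ z
  xz≡z = ⟨$⟩ʳ-injective x x-fixes-xz

disjoint-supports-commute : ∀ {m} (x y : 𝔖 m) → (∀ z → x ⟨$⟩ʳ z ≡ z ⊎ y ⟨$⟩ʳ z ≡ z) → x · y ≈ y · x
disjoint-supports-commute x y one-fixes z with one-fixes z
... | inj₂ yz≡z = trans (cong (x ⟨$⟩ʳ_) yz≡z) (sym (fixed-by-other⇒image-fixed x y one-fixes yz≡z))
... | inj₁ xz≡z = trans (fixed-by-other⇒image-fixed y x (swap ∘ one-fixes) xz≡z) (cong (y ⟨$⟩ʳ_) (sym xz≡z))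

-- Adjacent transpositions

s-lo : ∀ {m} (k : Fin m) → s k ⟨$⟩ʳ lo k ≡ hi k
s-lo k rewrite dec-true (lo k ≟ lo k) refl = refl

s-hi : ∀ {m} (k : Fin m) → s k ⟨$⟩ʳ hi k ≡ lo k
s-hi k rewrite dec-false (hi k ≟ lo k) (lo≢hi k ∘ sym) | dec-true (hi k ≟ hi k) refl = refl

s-fix : ∀ {m} (k : Fin m) z → toℕ z ≢ toℕ k → toℕ z ≢ suc (toℕ k) → s k ⟨$⟩ʳ z ≡ z
s-fix k z z≢k z≢1+k
  rewrite dec-false (z ≟ lo k) (z≢k ∘ λ z≡lo → trans (cong toℕ z≡lo) (toℕ-inject₁ k))
        | dec-false (z ≟ hi k) (z≢1+k ∘ cong toℕ) = refl

s-fixes-above : ∀ {m} {a : Fin m} {c z} → toℕ a ≤ c → 2 + c ≤ toℕ z → s a ⟨$⟩ʳ z ≡ z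
s-fixes-above {a = a} {c} {z} a≤c 2+c≤z =
  s-fix a z (λ z≡a → <⇒≢ a<z (sym z≡a)) (λ z≡1+a → <⇒≢ 1+a<z (sym z≡1+a))
  where
  1+a<z : suc (toℕ a) < toℕ z
  1+a<z = ≤-trans (s≤s (s≤s a≤c)) 2+c≤z
  a<z : toℕ a < toℕ z
  a<z = <-trans (n<1+n _) 1+a<z

s-fixes-below : ∀ {m} {a : Fin m} {c z} → c ≤ toℕ a → toℕ z < c → s a ⟨$⟩ʳ z ≡ z
s-fixes-below {a = a} {c} {z} c≤a z<c =
  s-fix a z (<⇒≢ z<a) (<⇒≢ (<-trans z<a (n<1+n _)))
  where
  z<a : toℕ z < toℕ a
  z<a = <-≤-trans z<c c≤a

s-commute : ∀ {m} (i j : Fin m) → toℕ i ≢ toℕ j → toℕ j ≢ suc (toℕ i) → toℕ i ≢ suc (toℕ j) →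
  s i · s j ≈ s j · s i
s-commute i j i≢j j≢1+i i≢1+j = disjoint-supports-commute (s i) (s j) one-fixes
  where
  one-fixes : ∀ z → s i ⟨$⟩ʳ z ≡ z ⊎ s j ⟨$⟩ʳ z ≡ z
  one-fixes z with toℕ z ≟ℕ toℕ i | toℕ z ≟ℕ suc (toℕ i)
  ... | yes z≡i | _ = inj₂ (s-fix j z (i≢j ∘ trans (sym z≡i)) (i≢1+j ∘ trans (sym z≡i)))
  ... | no _ | yes z≡1+i = inj₂ (s-fix j z (j≢1+i ∘ λ z≡j → trans (sym z≡j) z≡1+i)
                                           (i≢j ∘ suc-injective ∘ trans (sym z≡1+i)))
  ... | no z≢i | no z≢1+i = inj₁ (s-fix i z z≢i z≢1+i)

data SwapView (k : ℕ) : ℕ → ℕ → Set where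
  lo↦hi : SwapView k k (suc k)
  hi↦lo : SwapView k (suc k) k
  fixed : ∀ {z} → z ≢ k → z ≢ suc k → SwapView k z z

swapView : ∀ {m} (k : Fin m) z → SwapView (toℕ k) (toℕ z) (toℕ (s k ⟨$⟩ʳ z))
swapView k z with toℕ z ≟ℕ toℕ k | toℕ z ≟ℕ suc (toℕ k)
... | yes z≡k | _ = subst₂ (SwapView (toℕ k)) (sym z≡k) (sym (cong toℕ s-at-lo)) lo↦hi
  where
  s-at-lo : s k ⟨$⟩ʳ z ≡ hi k
  s-at-lo = trans (cong (s k ⟨$⟩ʳ_) (≡lo z≡k)) (s-lo k)
... | no _ | yes z≡1+k = subst₂ (SwapView (toℕ k)) (sym z≡1+k) (sym s-at-hi) hi↦lo
  where
  s-at-hi : toℕ (s k ⟨$⟩ʳ z) ≡ toℕ k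
  s-at-hi = trans (cong toℕ (trans (cong (s k ⟨$⟩ʳ_) (≡hi z≡1+k)) (s-hi k))) (toℕ-inject₁ k)
... | no z≢k | no z≢1+k =
  subst (SwapView (toℕ k) (toℕ z)) (sym (cong toℕ (s-fix k z z≢k z≢1+k))) (fixed z≢k z≢1+k)

swapView-sym : ∀ {k a b} → SwapView k a b → SwapView k b a
swapView-sym lo↦hi = hi↦lo
swapView-sym hi↦lo = lo↦hi
swapView-sym (fixed a≢k a≢1+k) = fixed a≢k a≢1+k

swapView-functional : ∀ {k a b c} → SwapView k a b → SwapView k a c → b ≡ c
swapView-functional lo↦hi lo↦hi = refl
swapView-functional lo↦hi (fixed k≢k _) = ⊥-elim (k≢k refl)
swapView-functional hi↦lo hi↦lo = refl
swapView-functional hi↦lo (fixed _ 1+k≢1+k) = ⊥-elim (1+k≢1+k refl)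
swapView-functional (fixed k≢k _) lo↦hi = ⊥-elim (k≢k refl)
swapView-functional (fixed _ 1+k≢1+k) hi↦lo = ⊥-elim (1+k≢1+k refl)
swapView-functional (fixed _ _) (fixed _ _) = refl

s-involutive : ∀ {m} (k : Fin m) z → s k ⟨$⟩ʳ (s k ⟨$⟩ʳ z) ≡ z
s-involutive k z =
  toℕ-injective (swapView-functional (swapView k (s k ⟨$⟩ʳ z)) (swapView-sym (swapView k z)))

swap-keeps-above : ∀ {k a y z} → SwapView a y z → k < y → k < z ⊎ (a ≡ k × y ≡ suc k)
swap-keeps-above lo↦hi k<a = inj₁ (m<n⇒m<1+n k<a)
swap-keeps-above {k} {a} hi↦lo k<1+a with a ≟ℕ k
... | yes refl = inj₂ (refl , refl)
... | no a≢k = inj₁ (≤∧≢⇒< (≤-pred k<1+a) (a≢k ∘ sym))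
swap-keeps-above (fixed _ _) k<y = inj₁ k<y

χ< : ℕ → ℕ → ℕ
χ< _       zero    = 0
χ< zero    (suc _) = 1
χ< (suc a) (suc b) = χ< a b

χ<-yes : ∀ {a b} → a < b → χ< a b ≡ 1
χ<-yes {zero}  {suc b} _         = refl
χ<-yes {suc a} {suc b} (s≤s a<b) = χ<-yes a<b

χ<-no : ∀ {a b} → b ≤ a → χ< a b ≡ 0
χ<-no {b = zero}          _         = refl
χ<-no {suc a} {suc b} (s≤s b≤a) = χ<-no b≤a

χ<-asym : ∀ a b → χ< a b * χ< b a ≡ 0
χ<-asym zero    zero    = refl
χ<-asym zero    (suc b) = refl
χ<-asym (suc a) zero    = refl
χ<-asym (suc a) (suc b) = χ<-asym a b

χ<-sucˡ : ∀ a b → b ≢ suc a → χ< (suc a) b ≡ χ< a b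
χ<-sucˡ a       zero          _      = refl
χ<-sucˡ zero    (suc zero)    1≢1    = ⊥-elim (1≢1 refl)
χ<-sucˡ zero    (suc (suc b)) _      = refl
χ<-sucˡ (suc a) (suc b)       b≢1+a  = χ<-sucˡ a b (b≢1+a ∘ cong suc)

χ<-sucʳ : ∀ a b → a ≢ b → χ< a (suc b) ≡ χ< a b
χ<-sucʳ zero    zero    0≢0 = ⊥-elim (0≢0 refl)
χ<-sucʳ zero    (suc b) _   = refl
χ<-sucʳ (suc a) zero    _   = refl
χ<-sucʳ (suc a) (suc b) a≢b = χ<-sucʳ a b (a≢b ∘ cong suc)

χ<-swap : ∀ {k a a′ b b′} → SwapView k a a′ → SwapView k b b′ →
  ¬ (a ≡ k × b ≡ suc k) → ¬ (a ≡ suc k × b ≡ k) → χ< a′ b′ ≡ χ< a b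
χ<-swap lo↦hi         lo↦hi         _ _ = refl
χ<-swap lo↦hi         hi↦lo         ¬lohi _ = ⊥-elim (¬lohi (refl , refl))
χ<-swap lo↦hi         (fixed _ b≢1+k) _ _ = χ<-sucˡ _ _ b≢1+k
χ<-swap hi↦lo         lo↦hi         _ ¬hilo = ⊥-elim (¬hilo (refl , refl))
χ<-swap hi↦lo         hi↦lo         _ _ = refl
χ<-swap hi↦lo         (fixed _ b≢1+k) _ _ = sym (χ<-sucˡ _ _ b≢1+k)
χ<-swap (fixed a≢k _) lo↦hi         _ _ = χ<-sucʳ _ _ a≢k
χ<-swap (fixed a≢k _) hi↦lo         _ _ = sym (χ<-sucʳ _ _ a≢k)
χ<-swap (fixed _ _)   (fixed _ _)   _ _ = refl

χ<-step : ∀ {A B a b} → A + χ< b a ≡ B + χ< a b → a < b → A ≡ suc B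
χ<-step {A} {B} {a} {b} eq a<b = begin
  A           ≡⟨ sym (+-identityʳ A) ⟩
  A + 0       ≡⟨ cong (A +_) (sym (χ<-no (<⇒≤ a<b))) ⟩
  A + χ< b a  ≡⟨ eq ⟩
  B + χ< a b  ≡⟨ cong (B +_) (χ<-yes a<b) ⟩
  B + 1       ≡⟨ +-comm B 1 ⟩
  suc B       ∎
  where open ≡-Reasoning

-- Sums over Fin n

sum² : ∀ {n} → (Fin n → Fin n → ℕ) → ℕ
sum² G = sum (λ p → sum (G p))

sum-except : ∀ {n} (g h : Fin n → ℕ) a → (∀ z → z ≢ a → g z ≡ h z) → sum g + h a ≡ sum h + g a
sum-except {suc n} g h a agree = begin
  sum g + h a                     ≡⟨ cong (_+ h a) (sum-remove {i = a} g) ⟩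
  g a + sum (removeAt g a) + h a  ≡⟨ cong (λ t → g a + t + h a) (sum-cong-≗ (λ z → agree _ (punchInᵢ≢i a z))) ⟩
  g a + sum (removeAt h a) + h a  ≡⟨ swap-outer (g a) _ (h a) ⟩
  h a + sum (removeAt h a) + g a  ≡⟨ cong (_+ g a) (sym (sum-remove {i = a} h)) ⟩
  sum h + g a                     ∎
  where
  open ≡-Reasoning
  swap-outer : ∀ x y z → x + y + z ≡ z + y + x
  swap-outer = solve-∀

sum²-except : ∀ {n} (G H : Fin n → Fin n → ℕ) a b → (∀ p q → ¬ (p ≡ a × q ≡ b) → G p q ≡ H p q) →
  sum² G + H a b ≡ sum² H + G a b
sum²-except G H a b agree = transfer {sum² G} {sum² H} {sum (G a)} {sum (H a)} rows row-a
  where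
  rows : sum² G + sum (H a) ≡ sum² H + sum (G a)
  rows = sum-except _ _ a (λ p p≢a → sum-cong-≗ (λ q → agree p q (p≢a ∘ proj₁)))
  row-a : sum (G a) + H a b ≡ sum (H a) + G a b
  row-a = sum-except (G a) (H a) b (λ q q≢b → agree a q (q≢b ∘ proj₂))
  transfer : ∀ {x y g h c d} → x + h ≡ y + g → g + c ≡ h + d → x + c ≡ y + d
  transfer {x} {y} {g} {h} {c} {d} e₁ e₂ = +-cancelʳ-≡ (g + h) (x + c) (y + d) (begin
    x + c + (g + h)    ≡⟨ regroup x c g h ⟩
    (x + h) + (g + c)  ≡⟨ cong₂ _+_ e₁ e₂ ⟩
    (y + g) + (h + d)  ≡⟨ sym (regroup y d h g) ⟩
    y + d + (h + g)    ≡⟨ cong (y + d +_) (+-comm h g) ⟩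
    y + d + (g + h)    ∎)
    where
    open ≡-Reasoning
    regroup : ∀ x c g h → x + c + (g + h) ≡ (x + h) + (g + c)
    regroup = solve-∀

sum²-except₂ : ∀ {n} (G H : Fin n → Fin n → ℕ) a b c d → a ≢ c →
  (∀ p q → ¬ (p ≡ a × q ≡ b) → ¬ (p ≡ c × q ≡ d) → G p q ≡ H p q) →
  sum² G + H a b + H c d ≡ sum² H + G a b + G c d
sum²-except₂ G H a b c d a≢c agree = transfer {sum² G} {sum² M} {sum² H} G~M M~H
  where
  -- M takes its (c , d) entry from H and all others from G.
  M : _ → _ → ℕ
  M = updateAt G c (λ row → updateAt row d (λ _ → H c d))
  M-cd : M c d ≡ H c d
  M-cd = trans (cong (λ row → row d) (updateAt-updates c {f = λ row → updateAt row d (λ _ → H c d)} G))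
               (updateAt-updates d (G c))
  M-off : ∀ p q → ¬ (p ≡ c × q ≡ d) → M p q ≡ G p q
  M-off p q ¬cd with p ≟ c
  ... | yes refl = trans (cong (λ row → row q) (updateAt-updates p {f = λ row → updateAt row d (λ _ → H p d)} G))
                         (updateAt-minimal q d (G p) (λ q≡d → ¬cd (refl , q≡d)))
  ... | no p≢c = cong (λ row → row q) (updateAt-minimal p c G p≢c)
  G~M : sum² G + H c d ≡ sum² M + G c d
  G~M = subst (λ t → sum² G + t ≡ sum² M + G c d) M-cd
          (sum²-except G M c d (λ p q ¬cd → sym (M-off p q ¬cd)))
  M~H : sum² M + H a b ≡ sum² H + G a b
  M~H = subst (λ t → sum² M + H a b ≡ sum² H + t) (M-off a b (a≢c ∘ proj₁))
          (sum²-except M H a b M≗H)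
    where
    M≗H : ∀ p q → ¬ (p ≡ a × q ≡ b) → M p q ≡ H p q
    M≗H p q ¬ab with (p ≟ c) ×-dec (q ≟ d)
    ... | yes (refl , refl) = M-cd
    ... | no ¬cd = trans (M-off p q ¬cd) (agree p q ¬ab ¬cd)
  transfer : ∀ {x y z r s t u} → x + r ≡ y + s → y + t ≡ z + u → x + t + r ≡ z + u + s
  transfer {x} {y} {z} {r} {s} {t} {u} e₁ e₂ = +-cancelʳ-≡ y (x + t + r) (z + u + s) (begin
    x + t + r + y    ≡⟨ regroup x t r y ⟩
    (x + r) + t + y  ≡⟨ cong (λ v → v + t + y) e₁ ⟩
    (y + s) + t + y  ≡⟨ regroup′ y s t ⟩
    (y + t) + s + y  ≡⟨ cong (λ v → v + s + y) e₂ ⟩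
    (z + u) + s + y  ∎)
    where
    open ≡-Reasoning
    regroup : ∀ x t r y → x + t + r + y ≡ (x + r) + t + y
    regroup = solve-∀
    regroup′ : ∀ y s t → (y + s) + t + y ≡ (y + t) + s + y
    regroup′ = solve-∀

-- Inversions and Coxeter length

-- discord f g counts the ordered pairs (p , q) put in opposite orders by f and g
-- (the Kendall tau distance); inv x = discord e x is the number of inversions of x.
discordant : ∀ {m} → 𝔖 m → 𝔖 m → Fin (suc m) → Fin (suc m) → ℕ
discordant f g p q = χ< (toℕ (f ⟨$⟩ʳ p)) (toℕ (f ⟨$⟩ʳ q)) * χ< (toℕ (g ⟨$⟩ʳ q)) (toℕ (g ⟨$⟩ʳ p))

discord : ∀ {m} → 𝔖 m → 𝔖 m → ℕ
discord f g = sum² (discordant f g)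

discord-cong : ∀ {m} {f f′ g g′ : 𝔖 m} → f ≈ f′ → g ≈ g′ → discord f g ≡ discord f′ g′
discord-cong f≈f′ g≈g′ = sum-cong-≗ (λ p → sum-cong-≗ (λ q →
  cong₂ _*_ (cong₂ (λ a b → χ< (toℕ a) (toℕ b)) (f≈f′ p) (f≈f′ q))
            (cong₂ (λ a b → χ< (toℕ a) (toℕ b)) (g≈g′ q) (g≈g′ p))))

discord-sym : ∀ {m} (f g : 𝔖 m) → discord f g ≡ discord g f
discord-sym {m} f g = trans (∑-comm (discordant f g)) (sum-cong-≗ {suc m} (λ q → sum-cong-≗ {suc m} (λ p →
  *-comm (χ< (toℕ (f ⟨$⟩ʳ p)) (toℕ (f ⟨$⟩ʳ q))) (χ< (toℕ (g ⟨$⟩ʳ q)) (toℕ (g ⟨$⟩ʳ p))))))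

discord-reindex : ∀ {m} (f g π : 𝔖 m) → discord f g ≡ discord (f · π) (g · π)
discord-reindex f g π = trans (sum-permute (λ p → sum (discordant f g p)) π)
                              (sum-cong-≗ (λ p → sum-permute (discordant f g (π ⟨$⟩ʳ p)) π))

discordant-s·-off : ∀ {m} (k : Fin m) (f g : 𝔖 m) p q →
  ¬ (p ≡ f ⟨$⟩ˡ lo k × q ≡ f ⟨$⟩ˡ hi k) → ¬ (p ≡ f ⟨$⟩ˡ hi k × q ≡ f ⟨$⟩ˡ lo k) →
  discordant (s k · f) g p q ≡ discordant f g p q
discordant-s·-off k f g p q ¬lohi ¬hilo = cong (_* _) (χ<-swap (swapView k (f ⟨$⟩ʳ p)) (swapView k (f ⟨$⟩ʳ q))
  (λ { (fp≡k , fq≡1+k) → ¬lohi (preimage (≡lo fp≡k) , preimage (≡hi fq≡1+k)) })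
  (λ { (fp≡1+k , fq≡k) → ¬hilo (preimage (≡hi fp≡1+k) , preimage (≡lo fq≡k)) }))
  where
  preimage : ∀ {z y} → f ⟨$⟩ʳ z ≡ y → z ≡ f ⟨$⟩ˡ y
  preimage fz≡y = trans (sym (inverseˡ f)) (cong (f ⟨$⟩ˡ_) fz≡y)

-- Only the pair of points that f sends to k and k + 1 changes status.
discord-swap : ∀ {m} (k : Fin m) (f g : 𝔖 m) →
  discord (s k · f) g + χ< (toℕ (g ⟨$⟩ʳ (f ⟨$⟩ˡ hi k))) (toℕ (g ⟨$⟩ʳ (f ⟨$⟩ˡ lo k))) ≡
  discord f g + χ< (toℕ (g ⟨$⟩ʳ (f ⟨$⟩ˡ lo k))) (toℕ (g ⟨$⟩ʳ (f ⟨$⟩ˡ hi k)))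
discord-swap {m} k f g = begin
  sum² G + χ< gQ gP              ≡⟨ cong (sum² G +_) (sym (+-identityʳ _)) ⟩
  sum² G + (χ< gQ gP + 0)        ≡⟨ cong (sum² G +_) (sym (cong₂ _+_ H-PQ H-QP)) ⟩
  sum² G + (H P Q + H Q P)       ≡⟨ reassoc (sum² G) _ _ ⟩
  sum² G + H P Q + H Q P         ≡⟨ sum²-except₂ G H P Q Q P (⟨$⟩ˡ-lo≢hi f k) (discordant-s·-off k f g) ⟩
  sum² H + G P Q + G Q P         ≡⟨ cong₂ (λ a b → sum² H + a + b) G-PQ G-QP ⟩
  sum² H + 0 + χ< gP gQ          ≡⟨ cong (_+ χ< gP gQ) (+-identityʳ _) ⟩
  sum² H + χ< gP gQ              ∎
  where
  open ≡-Reasoning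
  K = toℕ k
  P = f ⟨$⟩ˡ lo k
  Q = f ⟨$⟩ˡ hi k
  gP = toℕ (g ⟨$⟩ʳ P)
  gQ = toℕ (g ⟨$⟩ʳ Q)
  G H : Fin (suc m) → Fin (suc m) → ℕ
  G = discordant (s k · f) g
  H = discordant f g
  reassoc : ∀ x y z → x + (y + z) ≡ x + y + z
  reassoc = solve-∀
  fP : toℕ (f ⟨$⟩ʳ P) ≡ K
  fP = trans (cong toℕ (inverseʳ f)) (toℕ-inject₁ k)
  fQ : toℕ (f ⟨$⟩ʳ Q) ≡ suc K
  fQ = cong toℕ (inverseʳ f)
  sfP : toℕ (s k ⟨$⟩ʳ (f ⟨$⟩ʳ P)) ≡ suc K
  sfP = cong toℕ (trans (cong (s k ⟨$⟩ʳ_) (inverseʳ f)) (s-lo k))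
  sfQ : toℕ (s k ⟨$⟩ʳ (f ⟨$⟩ʳ Q)) ≡ K
  sfQ = trans (cong toℕ (trans (cong (s k ⟨$⟩ʳ_) (inverseʳ f)) (s-hi k))) (toℕ-inject₁ k)
  ascending : ∀ {a b} c → a ≡ K → b ≡ suc K → χ< a b * c ≡ c
  ascending c refl refl = trans (cong (_* c) (χ<-yes (n<1+n K))) (*-identityˡ c)
  descending : ∀ {a b} c → a ≡ suc K → b ≡ K → χ< a b * c ≡ 0
  descending c refl refl = cong (_* c) (χ<-no (n≤1+n K))
  H-PQ : H P Q ≡ χ< gQ gP
  H-PQ = ascending _ fP fQ
  H-QP : H Q P ≡ 0
  H-QP = descending _ fQ fP
  G-PQ : G P Q ≡ 0
  G-PQ = descending _ sfP sfQ
  G-QP : G Q P ≡ χ< gP gQ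
  G-QP = ascending _ sfQ sfP

inv : ∀ {m} → 𝔖 m → ℕ
inv = discord e

inv-cong : ∀ {m} {x y : 𝔖 m} → x ≈ y → inv x ≡ inv y
inv-cong {x = x} {y} x≈y = discord-cong {f = e} {e} {x} {y} (λ _ → refl) x≈y

inv-e : ∀ {m} → inv (e {m}) ≡ 0
inv-e {m} = trans (sum-cong-≗ {suc m} row-zero) (sum-replicate-zero (suc m))
  where
  row-zero : ∀ p → sum (discordant e e p) ≡ 0
  row-zero p = trans (sum-cong-≗ {suc m} (λ q → χ<-asym (toℕ p) (toℕ q))) (sum-replicate-zero (suc m))

inv-s· : ∀ {m} (x : 𝔖 m) k →
  inv (s k · x) + χ< (toℕ (x ⟨$⟩ˡ hi k)) (toℕ (x ⟨$⟩ˡ lo k)) ≡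
  inv x + χ< (toℕ (x ⟨$⟩ˡ lo k)) (toℕ (x ⟨$⟩ˡ hi k))
inv-s· x k = begin
  inv (s k · x) + χ< Q P       ≡⟨ cong (_+ χ< Q P) (discord-sym e (s k · x)) ⟩
  discord (s k · x) e + χ< Q P ≡⟨ discord-swap k x e ⟩
  discord x e + χ< P Q         ≡⟨ cong (_+ χ< P Q) (discord-sym x e) ⟩
  inv x + χ< P Q               ∎
  where
  open ≡-Reasoning
  P = toℕ (x ⟨$⟩ˡ lo k)
  Q = toℕ (x ⟨$⟩ˡ hi k)

inv-·s : ∀ {m} (x : 𝔖 m) k →
  inv (x · s k) + χ< (toℕ (x ⟨$⟩ʳ hi k)) (toℕ (x ⟨$⟩ʳ lo k)) ≡
  inv x + χ< (toℕ (x ⟨$⟩ʳ lo k)) (toℕ (x ⟨$⟩ʳ hi k))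
inv-·s x k = begin
  inv (x · s k) + χ< Q P                      ≡⟨ cong (_+ χ< Q P) (discord-reindex e (x · s k) (s k)) ⟩
  discord (e · s k) (x · s k · s k) + χ< Q P  ≡⟨ cong (_+ χ< Q P) (discord-cong {f = e · s k} {s k · e} {x · s k · s k} {x} (λ _ → refl) x·s·s≈x) ⟩
  discord (s k · e) x + χ< Q P                ≡⟨ discord-swap k e x ⟩
  inv x + χ< P Q                              ∎
  where
  open ≡-Reasoning
  P = toℕ (x ⟨$⟩ʳ lo k)
  Q = toℕ (x ⟨$⟩ʳ hi k)
  x·s·s≈x : x · s k · s k ≈ x
  x·s·s≈x z = cong (x ⟨$⟩ʳ_) (s-involutive k z)

inv-ascentˡ : ∀ {m} (x : 𝔖 m) k → toℕ (x ⟨$⟩ˡ lo k) < toℕ (x ⟨$⟩ˡ hi k) → inv (s k · x) ≡ suc (inv x)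
inv-ascentˡ x k = χ<-step (inv-s· x k)

inv-descentˡ : ∀ {m} (x : 𝔖 m) k → toℕ (x ⟨$⟩ˡ hi k) < toℕ (x ⟨$⟩ˡ lo k) → inv x ≡ suc (inv (s k · x))
inv-descentˡ x k = χ<-step (sym (inv-s· x k))

inv-descentʳ : ∀ {m} (x : 𝔖 m) k → toℕ (x ⟨$⟩ʳ hi k) < toℕ (x ⟨$⟩ʳ lo k) → inv x ≡ suc (inv (x · s k))
inv-descentʳ x k = χ<-step (sym (inv-·s x k))

inv-s·-≤ : ∀ {m} (x : 𝔖 m) k → inv (s k · x) ≤ suc (inv x)
inv-s·-≤ x k with <-cmp (x ⟨$⟩ˡ lo k) (x ⟨$⟩ˡ hi k)
... | tri< ascent _ _ = ≤-reflexive (inv-ascentˡ x k ascent)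
... | tri≈ _ lo≡hi _ = ⊥-elim (⟨$⟩ˡ-lo≢hi x k lo≡hi)
... | tri> _ _ descent = ≤-trans (n≤1+n _) (≤-trans (≤-reflexive (sym (inv-descentˡ x k descent))) (n≤1+n _))

inv-⟦⟧-≤ : ∀ {m} (r : Word m) → inv ⟦ r ⟧ ≤ length r
inv-⟦⟧-≤ {m} []  = ≤-reflexive (inv-e {m})
inv-⟦⟧-≤ (k ∷ r) = ≤-trans (inv-s·-≤ ⟦ r ⟧ k) (s≤s (inv-⟦⟧-≤ r))

increasing⇒inflationary : ∀ {m} (g : Fin (suc m) → ℕ) → (∀ k → g (inject₁ k) < g (fsuc k)) →
  ∀ z → toℕ z ≤ g z
increasing⇒inflationary g increasing = <-weakInduction (λ z → toℕ z ≤ g z) z≤n step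
  where
  step : ∀ k → toℕ (inject₁ k) ≤ g (inject₁ k) → suc (toℕ k) ≤ g (fsuc k)
  step k ih = ≤-trans (s≤s (subst (_≤ g (inject₁ k)) (toℕ-inject₁ k) ih)) (increasing k)

sum-mono-≤ : ∀ {n} {f g : Fin n → ℕ} → (∀ z → f z ≤ g z) → sum f ≤ sum g
sum-mono-≤ {zero}  _   = z≤n
sum-mono-≤ {suc n} f≤g = +-mono-≤ (f≤g fzero) (sum-mono-≤ (f≤g ∘ fsuc))

sum-mono-≤-≡⇒≗ : ∀ {n} {f g : Fin n → ℕ} → (∀ z → f z ≤ g z) → sum f ≡ sum g → ∀ z → f z ≡ g z
sum-mono-≤-≡⇒≗ {suc n} {f} {g} f≤g Σf≡Σg = pointwise
  where
  split : ∀ {a b c d} → a ≤ c → b ≤ d → a + b ≡ c + d → a ≡ c × b ≡ d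
  split {a} {b} {c} {d} a≤c b≤d eq = a≡c , +-cancelˡ-≡ c b d (trans (cong (_+ b) (sym a≡c)) eq)
    where
    a≡c : a ≡ c
    a≡c = ≤-antisym a≤c (+-cancelʳ-≤ b c a (≤-trans (+-monoʳ-≤ c b≤d) (≤-reflexive (sym eq))))
  heads-tails = split (f≤g fzero) (sum-mono-≤ (f≤g ∘ fsuc)) Σf≡Σg
  pointwise : ∀ z → f z ≡ g z
  pointwise fzero    = proj₁ heads-tails
  pointwise (fsuc z) = sum-mono-≤-≡⇒≗ (f≤g ∘ fsuc) (proj₂ heads-tails) z

-- An inflationary permutation is the identity, as it preserves the sum of all points.
ascents⇒≈e : ∀ {m} (x : 𝔖 m) → (∀ k → toℕ (x ⟨$⟩ˡ lo k) < toℕ (x ⟨$⟩ˡ hi k)) → x ≈ e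
ascents⇒≈e x ascents z = trans (cong (x ⟨$⟩ʳ_) (sym (x⁻¹-fixes z))) (inverseʳ x)
  where
  inflationary : ∀ y → toℕ y ≤ toℕ (x ⟨$⟩ˡ y)
  inflationary = increasing⇒inflationary (toℕ ∘ (x ⟨$⟩ˡ_)) ascents
  x⁻¹-fixes : ∀ y → x ⟨$⟩ˡ y ≡ y
  x⁻¹-fixes y = toℕ-injective (sym (sum-mono-≤-≡⇒≗ inflationary (sum-permute toℕ (flip x)) y))

descending-word : ∀ {m} n (x : 𝔖 m) → inv x ≡ n → Σ (Word m) λ r → ⟦ r ⟧ ≈ x × length r ≡ n
descending-word n x inv≡n with any? (λ k → toℕ (x ⟨$⟩ˡ hi k) <? toℕ (x ⟨$⟩ˡ lo k))
descending-word {m} n x inv≡n | no no-descent =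
  [] , ≈-sym {x = x} {e} x≈e , trans (sym (trans (inv-cong {x = x} {e} x≈e) (inv-e {m}))) inv≡n
  where
  x≈e : x ≈ e
  x≈e = ascents⇒≈e x (λ k → ≤∧≢⇒< (≮⇒≥ (λ descent → no-descent (k , descent)))
                                  (⟨$⟩ˡ-lo≢hi x k ∘ toℕ-injective))
descending-word zero x inv≡0 | yes (k , descent) =
  ⊥-elim (1+n≢0 (trans (sym (inv-descentˡ x k descent)) inv≡0))
descending-word (suc n) x inv≡1+n | yes (k , descent)
  with descending-word n (s k · x) (suc-injective (trans (sym (inv-descentˡ x k descent)) inv≡1+n))
... | r , r≈skx , length≡n =
  k ∷ r , (λ z → trans (cong (s k ⟨$⟩ʳ_) (r≈skx z)) (s-involutive k (x ⟨$⟩ʳ z))) , cong suc length≡n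

inv-hasLength : ∀ {m} (x : 𝔖 m) → HasLength x (inv x)
inv-hasLength x with descending-word (inv x) x refl
... | r , r≈x , length≡inv = r , (r≈x , minimal) , length≡inv
  where
  minimal : ∀ v → ⟦ v ⟧ ≈ x → length r ≤ length v
  minimal v v≈x = ≤-trans (≤-reflexive (trans length≡inv (inv-cong {x = x} {⟦ v ⟧} (≈-sym {x = ⟦ v ⟧} {x} v≈x)))) (inv-⟦⟧-≤ v)

hasLength⇒≡inv : ∀ {m} {x : 𝔖 m} {n} → HasLength x n → n ≡ inv x
hasLength⇒≡inv {x = x} (r , (r≈x , minimal) , refl) with inv-hasLength x
... | r′ , (r′≈x , _) , length≡inv =
  ≤-antisym (≤-trans (minimal r′ r′≈x) (≤-reflexive length≡inv))
            (≤-trans (≤-reflexive (inv-cong {x = x} {⟦ r ⟧} (≈-sym {x = ⟦ r ⟧} {x} r≈x))) (inv-⟦⟧-≤ r))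

¬InDL⇒ascent : ∀ {m} {x : 𝔖 m} {k} → ¬ InDL k x → toℕ (x ⟨$⟩ˡ lo k) < toℕ (x ⟨$⟩ˡ hi k)
¬InDL⇒ascent {x = x} {k} ¬descent with <-cmp (x ⟨$⟩ˡ lo k) (x ⟨$⟩ˡ hi k)
... | tri< ascent _ _ = ascent
... | tri≈ _ lo≡hi _ = ⊥-elim (⟨$⟩ˡ-lo≢hi x k lo≡hi)
... | tri> _ _ descent = ⊥-elim (¬descent (_ , _ , inv-hasLength (s k · x) , inv-hasLength x ,
                                           ≤-reflexive (sym (inv-descentˡ x k descent))))

notLonger-·s⇒ascent : ∀ {m} {x : 𝔖 m} {k} → NotLongerThan x (x · s k) → toℕ (x ⟨$⟩ʳ lo k) < toℕ (x ⟨$⟩ʳ hi k)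
notLonger-·s⇒ascent {x = x} {k} (_ , _ , has-a , has-b , a≤b) with <-cmp (x ⟨$⟩ʳ lo k) (x ⟨$⟩ʳ hi k)
... | tri< ascent _ _ = ascent
... | tri≈ _ lo≡hi _ = ⊥-elim (lo≢hi k (⟨$⟩ʳ-injective x lo≡hi))
... | tri> _ _ descent = ⊥-elim (1+n≰n (subst₂ _≤_ a≡1+b (hasLength⇒≡inv {x = x · s k} has-b) a≤b))
  where
  a≡1+b = trans (hasLength⇒≡inv {x = x} has-a) (inv-descentʳ x k descent)

-- Supports and parabolic cosets

⟦++⟧ : ∀ {m} (r r′ : Word m) → ⟦ r ++ r′ ⟧ ≈ ⟦ r ⟧ · ⟦ r′ ⟧
⟦++⟧ []      r′ z = refl
⟦++⟧ (a ∷ r) r′ z = cong (s a ⟨$⟩ʳ_) (⟦++⟧ r r′ z)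

inCoset-·s : ∀ {m} {J : Subset m} {w u : 𝔖 m} {k} → J k → InCoset J w u → InCoset J w (u · s k)
inCoset-·s {k = k} Jk (v , (r , r∈J , r≈v) , u≈wv) =
  v · s k , (r ++ k ∷ [] , ++⁺ r∈J (Jk ∷ᵃ []ᵃ) , λ z → trans (⟦++⟧ r (k ∷ []) z) (r≈v _)) , λ z → u≈wv _

minCosetRep-ascent : ∀ {m} {J : Subset m} {w u : 𝔖 m} {k} → J k → IsMinCosetRep J w u →
  toℕ (u ⟨$⟩ʳ lo k) < toℕ (u ⟨$⟩ʳ hi k)
minCosetRep-ascent {w = w} {u} {k} Jk (u∈wW , minimal) =
  notLonger-·s⇒ascent {x = u} (minimal (u · s k) (inCoset-·s {w = w} {u} Jk u∈wW))

⟦⟧-fixes : ∀ {m} (r : Word m) {z} → (∀ {a} → a ∈ r → s a ⟨$⟩ʳ z ≡ z) → ⟦ r ⟧ ⟨$⟩ʳ z ≡ z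
⟦⟧-fixes []      _     = refl
⟦⟧-fixes (a ∷ r) fixes = trans (cong (s a ⟨$⟩ʳ_) (⟦⟧-fixes r (fixes ∘ there))) (fixes (here refl))

Crosses : ∀ {m} → Fin m → 𝔖 m → Set
Crosses k x = ∃ λ p → toℕ p ≤ toℕ k × toℕ k < toℕ (x ⟨$⟩ʳ p)

⟦⟧-preserves-above : ∀ {m} {k : Fin m} (r : Word m) → ¬ k ∈ r → ∀ z → toℕ k < toℕ z → toℕ k < toℕ (⟦ r ⟧ ⟨$⟩ʳ z)
⟦⟧-preserves-above []      _   _ k<z = k<z
⟦⟧-preserves-above (a ∷ r) k∉r z k<z
  with swap-keeps-above (swapView a (⟦ r ⟧ ⟨$⟩ʳ z)) (⟦⟧-preserves-above r (k∉r ∘ there) z k<z)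
... | inj₁ k<z′ = k<z′
... | inj₂ (a≡k , _) = ⊥-elim (k∉r (here (toℕ-injective (sym a≡k))))

∈-∷-∉⇒≡ : ∀ {m} {k a : Fin m} {r} → k ∈ a ∷ r → ¬ k ∈ r → k ≡ a
∈-∷-∉⇒≡ (here k≡a)  _   = k≡a
∈-∷-∉⇒≡ (there k∈r) k∉r = ⊥-elim (k∉r k∈r)

Tight : ∀ {m} → Word m → Set
Tight r = length r ≡ inv ⟦ r ⟧

reduced⇒tight : ∀ {m} {x : 𝔖 m} {r} → Reduced x r → Tight r
reduced⇒tight {x = x} {r} reduced@(r≈x , _) =
  trans (hasLength⇒≡inv {x = x} (r , reduced , refl)) (inv-cong {x = x} {⟦ r ⟧} (≈-sym {x = ⟦ r ⟧} {x} r≈x))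

tight-∷ : ∀ {m} a (r : Word m) → Tight (a ∷ r) → Tight r × toℕ (⟦ r ⟧ ⟨$⟩ˡ lo a) < toℕ (⟦ r ⟧ ⟨$⟩ˡ hi a)
tight-∷ a r tight with <-cmp (⟦ r ⟧ ⟨$⟩ˡ lo a) (⟦ r ⟧ ⟨$⟩ˡ hi a)
... | tri< ascent _ _ = suc-injective (trans tight (inv-ascentˡ ⟦ r ⟧ a ascent)) , ascent
... | tri≈ _ lo≡hi _ = ⊥-elim (⟨$⟩ˡ-lo≢hi ⟦ r ⟧ a lo≡hi)
... | tri> _ _ descent = ⊥-elim (1+n≰n (≤-trans (n≤1+n _) (≤-trans (≤-reflexive 2+r≡inv) (inv-⟦⟧-≤ r))))
  where
  2+r≡inv : suc (suc (length r)) ≡ inv ⟦ r ⟧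
  2+r≡inv = sym (trans (inv-descentˡ ⟦ r ⟧ a descent) (cong suc (sym tight)))

-- If s a pulls the witness p down to a = k, the ascent of y at a gives the new witness y⁻¹ k < p.
crosses-ascentˡ : ∀ {m} {k a : Fin m} {y : 𝔖 m} → toℕ (y ⟨$⟩ˡ lo a) < toℕ (y ⟨$⟩ˡ hi a) →
  Crosses k y → Crosses k (s a · y)
crosses-ascentˡ {k = k} {a} {y} ascent (p , p≤k , k<yp) with swap-keeps-above (swapView a (y ⟨$⟩ʳ p)) k<yp
... | inj₁ k<xp = p , p≤k , k<xp
... | inj₂ (a≡k , yp≡1+k) = y ⟨$⟩ˡ lo a , p′≤k , k<xp′
  where
  p≡y⁻¹hi : p ≡ y ⟨$⟩ˡ hi a
  p≡y⁻¹hi = trans (sym (inverseˡ y)) (cong (y ⟨$⟩ˡ_) (≡hi (trans yp≡1+k (cong suc (sym a≡k)))))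
  p′≤k : toℕ (y ⟨$⟩ˡ lo a) ≤ toℕ k
  p′≤k = <⇒≤ (<-≤-trans (subst (λ t → toℕ (y ⟨$⟩ˡ lo a) < toℕ t) (sym p≡y⁻¹hi) ascent) p≤k)
  k<xp′ : toℕ k < toℕ (s a ⟨$⟩ʳ (y ⟨$⟩ʳ (y ⟨$⟩ˡ lo a)))
  k<xp′ = subst (λ t → toℕ k < toℕ (s a ⟨$⟩ʳ t)) (sym (inverseʳ y))
            (subst (λ t → toℕ k < toℕ t) (sym (s-lo a)) (s≤s (≤-reflexive (sym a≡k))))

s·⟦⟧-crosses : ∀ {m} (k : Fin m) (r : Word m) → ¬ k ∈ r → Crosses k (s k · ⟦ r ⟧)
s·⟦⟧-crosses k r k∉r = p , p≤k , k<xp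
  where
  y = ⟦ r ⟧
  p = y ⟨$⟩ˡ lo k
  yp≡k : toℕ (y ⟨$⟩ʳ p) ≡ toℕ k
  yp≡k = trans (cong toℕ (inverseʳ y)) (toℕ-inject₁ k)
  p≤k : toℕ p ≤ toℕ k
  p≤k = ≮⇒≥ (λ k<p → <-irrefl (sym yp≡k) (⟦⟧-preserves-above r k∉r p k<p))
  k<xp : toℕ k < toℕ (s k ⟨$⟩ʳ (y ⟨$⟩ʳ p))
  k<xp = subst (λ t → toℕ k < toℕ (s k ⟨$⟩ʳ t)) (sym (inverseʳ y))
           (subst (λ t → toℕ k < toℕ t) (sym (s-lo k)) (n<1+n _))

tight-crosses : ∀ {m} {k : Fin m} (r : Word m) → Tight r → k ∈ r → Crosses k ⟦ r ⟧
tight-crosses {k = k} (a ∷ r) tight k∈a∷r with tight-∷ a r tight | _∈?_ _≟_ k r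
... | tight-r , ascent | yes k∈r = crosses-ascentˡ {y = ⟦ r ⟧} ascent (tight-crosses r tight-r k∈r)
... | _ | no k∉r with ∈-∷-∉⇒≡ k∈a∷r k∉r
...   | refl = s·⟦⟧-crosses k r k∉r

inSupp⇒crosses : ∀ {m} {k : Fin m} {x} → InSupp k x → Crosses k x
inSupp⇒crosses {k = k} {x} (r , reduced@(r≈x , _) , k∈r) with tight-crosses r (reduced⇒tight {x = x} {r} reduced) k∈r
... | p , p≤k , k<rp = p , p≤k , subst (λ t → toℕ k < toℕ t) (r≈x p) k<rp

-- Almost reducible elements

data Position {m} (k : Fin m) (z : Fin (suc m)) : Set where
  below : toℕ z < toℕ k → Position k z
  at-lo : z ≡ lo k → Position k z
  at-hi : z ≡ hi k → Position k z
  above : 2 + toℕ k ≤ toℕ z → Position k z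

position : ∀ {m} (k : Fin m) z → Position k z
position k z with <-cmpℕ (toℕ z) (toℕ k)
... | tri< z<k _ _ = below z<k
... | tri≈ _ z≡k _ = at-lo (≡lo z≡k)
... | tri> _ _ k<z with toℕ z ≟ℕ suc (toℕ k)
...   | yes z≡1+k = at-hi (≡hi z≡1+k)
...   | no z≢1+k = above (≤∧≢⇒< k<z (z≢1+k ∘ sym))

preimage-hi-below : ∀ {m} (u : 𝔖 m) (i : Fin m) →
  (∀ z → 2 + toℕ i ≤ toℕ z → u ⟨$⟩ʳ z ≡ z) →
  toℕ (u ⟨$⟩ʳ lo i) < toℕ (u ⟨$⟩ʳ hi i) →
  Crosses i u →
  toℕ (u ⟨$⟩ˡ hi i) < toℕ i
preimage-hi-below u i fixes-above ascent (p , p≤i , i<up) =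
  subst (λ t → toℕ t < toℕ i) (sym u⁻¹hi≡p) (≤∧≢⇒< p≤i p≢i)
  where
  bounded : ∀ z → toℕ z < 2 + toℕ i → toℕ (u ⟨$⟩ʳ z) < 2 + toℕ i
  bounded = fixing-above⇒preserves-below u (2 + toℕ i) fixes-above
  up≡hi : u ⟨$⟩ʳ p ≡ hi i
  up≡hi = ≡hi (≤-antisym (≤-pred (bounded p (s≤s (m≤n⇒m≤1+n p≤i)))) i<up)
  u⁻¹hi≡p : u ⟨$⟩ˡ hi i ≡ p
  u⁻¹hi≡p = trans (cong (u ⟨$⟩ˡ_) (sym up≡hi)) (inverseˡ u)
  p≢i : toℕ p ≢ toℕ i
  p≢i p≡i = <⇒≱ (bounded (hi i) ≤-refl) 2+i≤u-hi
    where
    2+i≤u-hi : 2 + toℕ i ≤ toℕ (u ⟨$⟩ʳ hi i)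
    2+i≤u-hi = subst (λ t → toℕ t < toℕ (u ⟨$⟩ʳ hi i)) (trans (cong (u ⟨$⟩ʳ_) (sym (≡lo p≡i))) up≡hi) ascent

preimage-lo-above : ∀ {m} (u : 𝔖 m) (j : Fin m) →
  (∀ z → toℕ z < toℕ j → u ⟨$⟩ʳ z ≡ z) →
  toℕ (u ⟨$⟩ʳ lo j) < toℕ (u ⟨$⟩ʳ hi j) →
  Crosses j u →
  2 + toℕ j ≤ toℕ (u ⟨$⟩ˡ lo j)
preimage-lo-above u j fixes-below ascent (p , p≤j , j<up) = above-of (position j d)
  where
  d = u ⟨$⟩ˡ lo j
  ud≡j : toℕ (u ⟨$⟩ʳ d) ≡ toℕ j
  ud≡j = trans (cong toℕ (inverseʳ u)) (toℕ-inject₁ j)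
  p≡lo : p ≡ lo j
  p≡lo = ≡lo (≤-antisym p≤j (≮⇒≥ (λ p<j → <⇒≱ j<up (subst (λ t → toℕ t ≤ toℕ j) (sym (fixes-below p p<j)) p≤j))))
  j<u-lo : toℕ j < toℕ (u ⟨$⟩ʳ lo j)
  j<u-lo = subst (λ t → toℕ j < toℕ (u ⟨$⟩ʳ t)) p≡lo j<up
  above-of : Position j d → 2 + toℕ j ≤ toℕ d
  above-of (below d<j) = ⊥-elim (<-irrefl (trans (cong toℕ (sym (fixes-below d d<j))) ud≡j) d<j)
  above-of (at-lo d≡lo) = ⊥-elim (<-irrefl (sym (subst (λ t → toℕ (u ⟨$⟩ʳ t) ≡ toℕ j) d≡lo ud≡j)) j<u-lo)
  above-of (at-hi d≡hi) = ⊥-elim (<-irrefl (sym (subst (λ t → toℕ (u ⟨$⟩ʳ t) ≡ toℕ j) d≡hi ud≡j)) (<-trans j<u-lo ascent))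
  above-of (above 2+j≤d) = 2+j≤d

rightAlmostReducible⇒preimages-below : ∀ {m} {w : 𝔖 m} {i} → RightAlmostReducible w i →
  toℕ (w ⟨$⟩ˡ lo i) < toℕ i × toℕ (w ⟨$⟩ˡ hi i) < toℕ i
rightAlmostReducible⇒preimages-below {w = w} {i}
  (_ , u , v , (w≈uv , (rv , rv∈W , rv≈v) , u-min) , _ , supp∩J≡i , (ru , ru-red@(ru≈u , _) , i∈ru) , Ji , ¬descent , _) =
  <-trans (¬InDL⇒ascent {x = w} ¬descent) w⁻¹hi<i , w⁻¹hi<i
  where
  letter≤i : ∀ {a} → a ∈ ru → toℕ a ≤ toℕ i
  letter≤i {a} a∈ru with ≤-total (toℕ a) (toℕ i)
  ... | inj₁ a≤i = a≤i
  ... | inj₂ i≤a = ≤-reflexive (cong toℕ (supp∩J≡i a (ru , ru-red , a∈ru) i≤a))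
  u-fixes : ∀ z → 2 + toℕ i ≤ toℕ z → u ⟨$⟩ʳ z ≡ z
  u-fixes z 2+i≤z = trans (sym (ru≈u z)) (⟦⟧-fixes ru (λ a∈ru → s-fixes-above (letter≤i a∈ru) 2+i≤z))
  v-fixes : ∀ z → toℕ z < toℕ i → v ⟨$⟩ʳ z ≡ z
  v-fixes z z<i = trans (sym (rv≈v z)) (⟦⟧-fixes rv (λ a∈rv → s-fixes-below (lookup rv∈W a∈rv) z<i))
  u⁻¹hi<i : toℕ (u ⟨$⟩ˡ hi i) < toℕ i
  u⁻¹hi<i = preimage-hi-below u i u-fixes (minCosetRep-ascent {w = w} {u} Ji u-min)
                                          (inSupp⇒crosses {x = u} (ru , ru-red , i∈ru))
  w⁻¹hi≡u⁻¹hi : w ⟨$⟩ˡ hi i ≡ u ⟨$⟩ˡ hi i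
  w⁻¹hi≡u⁻¹hi = trans (⟨$⟩ˡ-· {w = w} {u} {v} w≈uv (hi i)) (fixed⇒inverse-fixed v (v-fixes _ u⁻¹hi<i))
  w⁻¹hi<i : toℕ (w ⟨$⟩ˡ hi i) < toℕ i
  w⁻¹hi<i = subst (λ t → toℕ t < toℕ i) (sym w⁻¹hi≡u⁻¹hi) u⁻¹hi<i

leftAlmostReducible⇒preimages-above : ∀ {m} {w : 𝔖 m} {j} → LeftAlmostReducible w j →
  2 + toℕ j ≤ toℕ (w ⟨$⟩ˡ lo j) × 2 + toℕ j ≤ toℕ (w ⟨$⟩ˡ hi j)
leftAlmostReducible⇒preimages-above {w = w} {j}
  (_ , u , v , (w≈uv , (rv , rv∈W , rv≈v) , u-min) , _ , supp∩J≡j , (ru , ru-red@(ru≈u , _) , j∈ru) , Jj , ¬descent , _) =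
  2+j≤w⁻¹lo , <⇒≤ (≤-<-trans 2+j≤w⁻¹lo (¬InDL⇒ascent {x = w} ¬descent))
  where
  j≤letter : ∀ {a} → a ∈ ru → toℕ j ≤ toℕ a
  j≤letter {a} a∈ru with ≤-total (toℕ j) (toℕ a)
  ... | inj₁ j≤a = j≤a
  ... | inj₂ a≤j = ≤-reflexive (cong toℕ (sym (supp∩J≡j a (ru , ru-red , a∈ru) a≤j)))
  u-fixes : ∀ z → toℕ z < toℕ j → u ⟨$⟩ʳ z ≡ z
  u-fixes z z<j = trans (sym (ru≈u z)) (⟦⟧-fixes ru (λ a∈ru → s-fixes-below (j≤letter a∈ru) z<j))
  v-fixes : ∀ z → 2 + toℕ j ≤ toℕ z → v ⟨$⟩ʳ z ≡ z
  v-fixes z 2+j≤z = trans (sym (rv≈v z)) (⟦⟧-fixes rv (λ a∈rv → s-fixes-above (lookup rv∈W a∈rv) 2+j≤z))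
  2+j≤u⁻¹lo : 2 + toℕ j ≤ toℕ (u ⟨$⟩ˡ lo j)
  2+j≤u⁻¹lo = preimage-lo-above u j u-fixes (minCosetRep-ascent {w = w} {u} Jj u-min)
                                            (inSupp⇒crosses {x = u} (ru , ru-red , j∈ru))
  w⁻¹lo≡u⁻¹lo : w ⟨$⟩ˡ lo j ≡ u ⟨$⟩ˡ lo j
  w⁻¹lo≡u⁻¹lo = trans (⟨$⟩ˡ-· {w = w} {u} {v} w≈uv (lo j)) (fixed⇒inverse-fixed v (v-fixes _ 2+j≤u⁻¹lo))
  2+j≤w⁻¹lo : 2 + toℕ j ≤ toℕ (w ⟨$⟩ˡ lo j)
  2+j≤w⁻¹lo = subst (λ t → 2 + toℕ j ≤ toℕ t) (sym w⁻¹lo≡u⁻¹lo) 2+j≤u⁻¹lo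

corollary5p6 : ∀ {m} (w : 𝔖 m) (i j : Fin m) →
    RightAlmostReducible w i → LeftAlmostReducible w j →
    (i ≢ j) × (s i · s j ≈ s j · s i)
corollary5p6 w i j R L
  with rightAlmostReducible⇒preimages-below {w = w} {i} R | leftAlmostReducible⇒preimages-above {w = w} {j} L
... | lo-i-below , hi-i-below | lo-j-above , hi-j-above =
  i≢j , s-commute i j (i≢j ∘ toℕ-injective) j≢1+i i≢1+j
  where
  shared-preimage : ∀ y → toℕ (w ⟨$⟩ˡ y) < toℕ i → 2 + toℕ j ≤ toℕ (w ⟨$⟩ˡ y) → toℕ i ≤ 2 + toℕ j → ⊥
  shared-preimage y y<i 2+j≤y i≤2+j = <-irrefl refl (<-≤-trans y<i (≤-trans i≤2+j 2+j≤y))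
  i≢j : i ≢ j
  i≢j refl = shared-preimage (lo i) lo-i-below lo-j-above (m≤n+m (toℕ i) 2)
  j≢1+i : toℕ j ≢ suc (toℕ i)
  j≢1+i j≡1+i = shared-preimage (hi i) hi-i-below
    (subst (λ y → 2 + toℕ j ≤ toℕ (w ⟨$⟩ˡ y)) (sym (≡lo (sym j≡1+i))) lo-j-above)
    (≤-trans (≤-trans (n≤1+n _) (≤-reflexive (sym j≡1+i))) (m≤n+m (toℕ j) 2))
  i≢1+j : toℕ i ≢ suc (toℕ j)
  i≢1+j i≡1+j = shared-preimage (lo i) lo-i-below
    (subst (λ y → 2 + toℕ j ≤ toℕ (w ⟨$⟩ˡ y)) (sym (≡hi (trans (toℕ-inject₁ i) i≡1+j))) hi-j-above)
    (≤-trans (≤-reflexive i≡1+j) (n≤1+n _))
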